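{- If $G$ is a finite simple graph of order $n(G)$ with no isolated vertices, then $Z(G)\le n(G)-\frac{\Gamma_t(G)}{2}$.
   Context: Zero forcing: initially a set $S\subseteq V(G)$ is colored blue; the color-change rule colors blue the unique non-blue neighbor of a blue vertex that has exactly one non-blue neighbor, applied as long as possible. $S$ is a zero forcing set if eventually all vertices are blue; $Z(G)$ is the minimum size of a zero forcing set. A total dominating set (TD-set) is a set $D$ such that every vertex has a neighbor in $D$; it is minimal if no proper subset is a TD-set; $\Gamma_t(G)$ is the maximum cardinality of a minimal TD-set. -}

module Defs where

open import Data.Nat using (ℕ; _≤_)
open import Data.Bool using (Bool; true; false)
open import Data.Fin using (Fin)
open import Data.Fin.Subset using (Subset; _∈_; _∉_; _⊂_; _∪_; ⁅_⁆; ⊤; ∣_∣)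
open import Data.Product using (Σ; ∃; _×_)
open import Relation.Binary.PropositionalEquality using (_≡_; _≢_)
open import Relation.Binary.Construct.Closure.ReflexiveTransitive using (Star)
open import Relation.Nullary using (¬_)

record Graph (n : ℕ) : Set where
  field
    adj   : Fin n → Fin n → Bool
    sym   : ∀ u v → adj u v ≡ adj v u
    irrefl : ∀ v → adj v v ≡ false

open Graph public

module _ {n : ℕ} (G : Graph n) where

  NoIsolated : Set
  NoIsolated = ∀ v → ∃ λ u → adj G v u ≡ true

  -- One application of the colour-change rule: a blue vertex v whose
  -- unique non-blue neighbour is w forces w to become blue.
  ForceStep : Subset n → Subset n → Set
  ForceStep S S' =
    Σ (Fin n) λ v → Σ (Fin n) λ w →
      v ∈ S × w ∉ S × adj G v w ≡ true
      × (∀ u → adj G v u ≡ true → u ≢ w → u ∈ S)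
      × S' ≡ S ∪ ⁅ w ⁆

  -- S is a zero forcing set: repeated forcing can turn every vertex blue.
  -- (The final colouring of the rule is independent of the order of forces.)
  ZeroForcingSet : Subset n → Set
  ZeroForcingSet S = Star ForceStep S ⊤

  IsZeroForcingNumber : ℕ → Set
  IsZeroForcingNumber k =
    (∃ λ S → ZeroForcingSet S × ∣ S ∣ ≡ k)
    × (∀ S → ZeroForcingSet S → k ≤ ∣ S ∣)

  TDSet : Subset n → Set
  TDSet D = ∀ v → ∃ λ u → adj G v u ≡ true × u ∈ D

  MinimalTDSet : Subset n → Set
  MinimalTDSet D = TDSet D × (∀ D' → D' ⊂ D → ¬ TDSet D')

  IsUpperTotalDomination : ℕ → Set
  IsUpperTotalDomination k =
    (∃ λ D → MinimalTDSet D × ∣ D ∣ ≡ k)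
    × (∀ D → MinimalTDSet D → ∣ D ∣ ≤ k)

-- A minimal total dominating set D gives every v ∈ D a private neighbour p v:
-- a vertex adjacent to v and to no other vertex of D.  So v is adjacent to no
-- p t with t ∈ D, t ≠ v, and a blue v can force p v once the earlier forces
-- are done.  Greedily pick v ∈ D, schedule the force v → p v first, discard v
-- and the vertex u ∈ D with p u = v (v has to start blue), and recurse.  Each
-- round uses at most two vertices of D and one private neighbour, so the
-- complement of a set W of at least |D|/2 private neighbours is zero forcing,
-- whence Z(G) ≤ n - |W| ≤ n - Γ_t(G)/2.
module Submission where

open import Defs
open import Data.Nat using (ℕ; suc; _+_; _*_; _∸_; _≤_; s≤s; z≤n)
open import Data.Nat.Properties
  using (≤-reflexive; ≤-trans; +-suc; n≤1+n; m≤n*m; +-monoˡ-≤; +-monoʳ-≤; *-monoʳ-≤; *-suc; *-distribˡ-+; m∸n+n≡m; module ≤-Reasoning)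
open import Data.Bool using (true) renaming (_≟_ to _≟ᵇ_)
open import Data.Fin using (Fin; zero; suc; _≟_)
open import Data.Fin.Properties using (any?; ¬∀⟶∃¬)
open import Data.Fin.Subset
open import Data.Fin.Subset.Properties
open import Data.Fin.Subset.Induction using (Acc; acc; ⊂-wellFounded)
open import Data.Vec using ([]; _∷_; there)
open import Data.Product using (∃; _×_; _,_; proj₁; proj₂)
open import Data.Sum using (_⊎_; inj₁; inj₂; [_,_]; map₂)
open import Function using (_∘_)
open import Relation.Nullary using (¬_; Dec; yes; no; contradiction)
open import Relation.Nullary.Decidable using (_×-dec_)
open import Relation.Binary.PropositionalEquality
  using (_≡_; _≢_; refl; trans; cong; subst) renaming (sym to ≡-sym)
open import Relation.Binary.Construct.Closure.ReflexiveTransitive using (Star; ε; _◅_)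

x∉p-x : ∀ {n} (p : Subset n) (x : Fin n) → x ∉ p - x
x∉p-x (s ∷ p) zero    ()
x∉p-x (s ∷ p) (suc x) (there x∈p-x) = x∉p-x p x x∈p-x

x∈p-y⇒x≢y : ∀ {n} {p : Subset n} {x y : Fin n} → x ∈ p - y → x ≢ y
x∈p-y⇒x≢y {p = p} {x} x∈p-y refl = x∉p-x p x x∈p-y

∣p∪q∣≤∣p∣+∣q∣ : ∀ {n} (p q : Subset n) → ∣ p ∪ q ∣ ≤ ∣ p ∣ + ∣ q ∣
∣p∪q∣≤∣p∣+∣q∣ []            []            = z≤n
∣p∪q∣≤∣p∣+∣q∣ (inside  ∷ p) (t       ∷ q) =
  s≤s (≤-trans (∣p∪q∣≤∣p∣+∣q∣ p q) (+-monoʳ-≤ ∣ p ∣ (∣p∣≤∣x∷p∣ t q)))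
∣p∪q∣≤∣p∣+∣q∣ (outside ∷ p) (inside  ∷ q) =
  ≤-trans (s≤s (∣p∪q∣≤∣p∣+∣q∣ p q)) (≤-reflexive (≡-sym (+-suc ∣ p ∣ ∣ q ∣)))
∣p∪q∣≤∣p∣+∣q∣ (outside ∷ p) (outside ∷ q) = ∣p∪q∣≤∣p∣+∣q∣ p q

∣p∣≤suc∣p-x∣ : ∀ {n} (p : Subset n) (x : Fin n) → ∣ p ∣ ≤ suc ∣ p - x ∣
∣p∣≤suc∣p-x∣ p x = begin
  ∣ p ∣                   ≤⟨ p⊆q⇒∣p∣≤∣q∣ p⊆⁅x⁆∪[p-x] ⟩
  ∣ ⁅ x ⁆ ∪ (p - x) ∣     ≤⟨ ∣p∪q∣≤∣p∣+∣q∣ ⁅ x ⁆ (p - x) ⟩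
  ∣ ⁅ x ⁆ ∣ + ∣ p - x ∣   ≡⟨ cong (_+ ∣ p - x ∣) (∣⁅x⁆∣≡1 x) ⟩
  suc ∣ p - x ∣           ∎
  where
  open ≤-Reasoning
  p⊆⁅x⁆∪[p-x] : p ⊆ ⁅ x ⁆ ∪ (p - x)
  p⊆⁅x⁆∪[p-x] {y} y∈p with y ≟ x
  ... | yes refl = x∈p∪q⁺ (inj₁ (x∈⁅x⁆ x))
  ... | no y≢x   = x∈p∪q⁺ (inj₂ (x∈p∧x≢y⇒x∈p-y y∈p y≢x))

x∈p∪⁅y⁆⁻ : ∀ {n} {p : Subset n} {x y : Fin n} → x ∈ p ∪ ⁅ y ⁆ → x ∈ p ⊎ x ≡ y
x∈p∪⁅y⁆⁻ {p = p} {y = y} = map₂ (x∈⁅y⁆⇒x≡y y) ∘ x∈p∪q⁻ p ⁅ y ⁆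

p∪⁅x⁆⊆p : ∀ {n} {p : Subset n} {x : Fin n} → x ∈ p → p ∪ ⁅ x ⁆ ⊆ p
p∪⁅x⁆⊆p x∈p y∈p∪⁅x⁆ with x∈p∪⁅y⁆⁻ y∈p∪⁅x⁆
... | inj₁ y∈p = y∈p
... | inj₂ refl = x∈p

∉p⇒∈q∪⁅y⁆ : ∀ {n} {p q : Subset n} {y : Fin n} →
             (∀ {x} → x ∉ p ∪ ⁅ y ⁆ → x ∈ q) → ∀ {x} → x ∉ p → x ∈ q ∪ ⁅ y ⁆
∉p⇒∈q∪⁅y⁆ {y = y} outside⊆q {x} x∉p with x ≟ y
... | yes refl = x∈p∪q⁺ (inj₂ (x∈⁅x⁆ y))
... | no x≢y   = x∈p∪q⁺ (inj₁ (outside⊆q ([ x∉p , x≢y ] ∘ x∈p∪⁅y⁆⁻)))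

module _ {n : ℕ} (G : Graph n) where

  adj-irrefl : ∀ {u v} → adj G u v ≡ true → u ≢ v
  adj-irrefl {u} uv refl with () ← trans (≡-sym uv) (irrefl G u)

  adj-sym : ∀ {u v} → adj G u v ≡ true → adj G v u ≡ true
  adj-sym {u} {v} uv = trans (Graph.sym G v u) uv

  -- Quantifying over every colouring that contains ∁ W, not only ∁ W itself,
  -- is what lets forces be chained.
  Forceable : Subset n → Set
  Forceable W = ∀ B → (∀ {x} → x ∉ W → x ∈ B) → Star (ForceStep G) B ⊤

  forceable-⊥ : Forceable ⊥
  forceable-⊥ B outside⊆B
    rewrite ⊆-antisym ⊆⊤ (λ {x} _ → outside⊆B {x} ∉⊥) = ε

  forceable-∪⁅⁆ : ∀ {W v w} → Forceable W → v ∉ W → adj G v w ≡ true →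
                  (∀ {u} → u ∈ W → adj G v u ≢ true) → Forceable (W ∪ ⁅ w ⁆)
  forceable-∪⁅⁆ {W} {v} {w} forceW v∉W vw noNbrInW B outside⊆B with w ∈? B
  ... | yes w∈B = forceW B (p∪⁅x⁆⊆p w∈B ∘ ∉p⇒∈q∪⁅y⁆ outside⊆B)
  ... | no w∉B = (v , w , v∈B , w∉B , vw , othersBlue , refl) ◅ forceW (B ∪ ⁅ w ⁆) (∉p⇒∈q∪⁅y⁆ outside⊆B)
    where
    v∈B : v ∈ B
    v∈B = outside⊆B ([ v∉W , adj-irrefl vw ] ∘ x∈p∪⁅y⁆⁻)
    othersBlue : ∀ u → adj G v u ≡ true → u ≢ w → u ∈ B
    othersBlue u vu u≢w = outside⊆B ([ (λ u∈W → noNbrInW u∈W vu) , u≢w ] ∘ x∈p∪⁅y⁆⁻)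

  Forceable⇒ZeroForcingSet : ∀ {W} → Forceable W → ZeroForcingSet G (∁ W)
  Forceable⇒ZeroForcingSet forceW = forceW (∁ _) x∉p⇒x∈∁p

  zeroForcingNumber+∣W∣≤n : ∀ {z W} → IsZeroForcingNumber G z → Forceable W → z + ∣ W ∣ ≤ n
  zeroForcingNumber+∣W∣≤n {z} {W} (_ , minimum) forceW = begin
    z + ∣ W ∣           ≤⟨ +-monoˡ-≤ ∣ W ∣ (minimum (∁ W) (Forceable⇒ZeroForcingSet forceW)) ⟩
    ∣ ∁ W ∣ + ∣ W ∣     ≡⟨ cong (_+ ∣ W ∣) (∣∁p∣≡n∸∣p∣ W) ⟩
    n ∸ ∣ W ∣ + ∣ W ∣   ≡⟨ m∸n+n≡m (∣p∣≤n W) ⟩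
    n                   ∎
    where open ≤-Reasoning

  IsPrivateNeighbour : Subset n → Fin n → Fin n → Set
  IsPrivateNeighbour D v x = adj G x v ≡ true × (∀ {u} → u ∈ D → adj G x u ≡ true → u ≡ v)

  minimalTDSet⇒privateNeighbour : ∀ {D v} → MinimalTDSet G D → v ∈ D → ∃ (IsPrivateNeighbour D v)
  minimalTDSet⇒privateNeighbour {D} {v} (isTD , minimal) v∈D = x , x~v , onlyV
    where
    HasNeighbourIn : Subset n → Fin n → Set
    HasNeighbourIn S x = ∃ λ u → adj G x u ≡ true × u ∈ S
    undominated : ∃ λ x → ¬ HasNeighbourIn (D - v) x
    undominated = ¬∀⟶∃¬ n (HasNeighbourIn (D - v))
      (λ x → any? λ u → (adj G x u ≟ᵇ true) ×-dec (u ∈? D - v))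
      (minimal (D - v) (x∈p⇒p-x⊂p v∈D))
    x : Fin n
    x = proj₁ undominated
    onlyV : ∀ {u} → u ∈ D → adj G x u ≡ true → u ≡ v
    onlyV {u} u∈D xu with u ≟ v
    ... | yes u≡v = u≡v
    ... | no u≢v  = contradiction (u , xu , x∈p∧x≢y⇒x∈p-y u∈D u≢v) (proj₂ undominated)
    x~v : adj G x v ≡ true
    x~v with u , xu , u∈D ← isTD x = subst (λ y → adj G x y ≡ true) (onlyV u∈D xu) xu

  minimalTDSet⇒privateNeighbourMap : ∀ {D} → MinimalTDSet G D →
    ∃ λ (p : Fin n → Fin n) → ∀ {v} → v ∈ D → IsPrivateNeighbour D v (p v)
  minimalTDSet⇒privateNeighbourMap {D} minimalD = (λ v → pick (v ∈? D)) , λ {v} → pick-private (v ∈? D)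
    where
    pick : ∀ {v} → Dec (v ∈ D) → Fin n
    pick (yes v∈D) = proj₁ (minimalTDSet⇒privateNeighbour minimalD v∈D)
    pick {v} (no _) = v
    pick-private : ∀ {v} (v∈D? : Dec (v ∈ D)) → v ∈ D → IsPrivateNeighbour D v (pick v∈D?)
    pick-private (yes v∈D) _   = proj₂ (minimalTDSet⇒privateNeighbour minimalD v∈D)
    pick-private (no v∉D) v∈D = contradiction v∈D v∉D

  module _ {D : Subset n} (p : Fin n → Fin n)
           (isPrivate : ∀ {v} → v ∈ D → IsPrivateNeighbour D v (p v)) where

    adj-p : ∀ {v} → v ∈ D → adj G v (p v) ≡ true
    adj-p v∈D = adj-sym (proj₁ (isPrivate v∈D))

    adj-p⇒≡ : ∀ {v t} → v ∈ D → t ∈ D → adj G v (p t) ≡ true → v ≡ t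
    adj-p⇒≡ v∈D t∈D v~pt = proj₂ (isPrivate t∈D) v∈D (adj-sym v~pt)

    p-injective : ∀ {t u} → t ∈ D → u ∈ D → p t ≡ p u → t ≡ u
    p-injective {t} t∈D u∈D pt≡pu = adj-p⇒≡ t∈D u∈D (subst (λ y → adj G t y ≡ true) pt≡pu (adj-p t∈D))

    dropPreimage : Subset n → Fin n → Subset n
    dropPreimage T v with any? (λ u → (u ∈? T) ×-dec (p u ≟ v))
    ... | yes (u , _) = T - u
    ... | no _        = T

    dropPreimage-⊆ : ∀ T v → dropPreimage T v ⊆ T
    dropPreimage-⊆ T v with any? (λ u → (u ∈? T) ×-dec (p u ≟ v))
    ... | yes (u , _) = p─q⊆p T ⁅ u ⁆
    ... | no _        = λ t∈T → t∈T

    dropPreimage-preimageFree : ∀ {T v t} → T ⊆ D → t ∈ dropPreimage T v → p t ≢ v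
    dropPreimage-preimageFree {T} {v} {t} T⊆D with any? (λ u → (u ∈? T) ×-dec (p u ≟ v))
    ... | yes (u , u∈T , pu≡v) = λ t∈T-u pt≡v → x∈p-y⇒x≢y t∈T-u
      (p-injective (T⊆D (p─q⊆p T ⁅ u ⁆ t∈T-u)) (T⊆D u∈T) (trans pt≡v (≡-sym pu≡v)))
    ... | no noPreimage = λ t∈T pt≡v → noPreimage (t , t∈T , pt≡v)

    ∣p∣≤suc∣dropPreimage∣ : ∀ T v → ∣ T ∣ ≤ suc ∣ dropPreimage T v ∣
    ∣p∣≤suc∣dropPreimage∣ T v with any? (λ u → (u ∈? T) ×-dec (p u ≟ v))
    ... | yes (u , _) = ∣p∣≤suc∣p-x∣ T u
    ... | no _        = n≤1+n ∣ T ∣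

    record ForceablePrivateNeighbours (T : Subset n) : Set where
      field
        W         : Subset n
        forceable : Forceable W
        half      : ∣ T ∣ ≤ 2 * ∣ W ∣
        image     : ∀ {x} → x ∈ W → ∃ λ t → t ∈ T × p t ≡ x

    forceablePrivateNeighbours : ∀ {T} → Acc _⊂_ T → T ⊆ D → ForceablePrivateNeighbours T
    forceablePrivateNeighbours {T} (acc smaller) T⊆D with nonempty? T
    ... | no empty = record
      { W         = ⊥
      ; forceable = forceable-⊥
      ; half      = ≤-trans (≤-reflexive (cong ∣_∣ (Empty-unique empty))) (m≤n*m ∣ ⊥ {n} ∣ 2)
      ; image     = λ x∈⊥ → contradiction x∈⊥ ∉⊥
      }
    ... | yes (v , v∈T) = record
      { W         = W ∪ ⁅ p v ⁆
      ; forceable = forceable-∪⁅⁆ forceable v∉W (adj-p v∈D) noNeighbourInW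
      ; half      = half′
      ; image     = image′
      }
      where
      T′ : Subset n
      T′ = dropPreimage (T - v) v
      T′⊆T-v : T′ ⊆ T - v
      T′⊆T-v = dropPreimage-⊆ (T - v) v
      T′⊂T : T′ ⊂ T
      T′⊂T = ⊆-⊂-trans T′⊆T-v (x∈p⇒p-x⊂p v∈T)
      T′⊆T : T′ ⊆ T
      T′⊆T = proj₁ T′⊂T
      open ForceablePrivateNeighbours (forceablePrivateNeighbours (smaller T′⊂T) (T⊆D ∘ T′⊆T))
      v∈D : v ∈ D
      v∈D = T⊆D v∈T
      v∉T′ : v ∉ T′
      v∉T′ = x∉p-x T v ∘ T′⊆T-v
      v∉W : v ∉ W
      v∉W v∈W with t , t∈T′ , pt≡v ← image v∈W =
        dropPreimage-preimageFree (T⊆D ∘ p─q⊆p T ⁅ v ⁆) t∈T′ pt≡v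
      noNeighbourInW : ∀ {u} → u ∈ W → adj G v u ≢ true
      noNeighbourInW u∈W v~u with t , t∈T′ , refl ← image u∈W =
        v∉T′ (subst (_∈ T′) (≡-sym (adj-p⇒≡ v∈D (T⊆D (T′⊆T t∈T′)) v~u)) t∈T′)
      half′ : ∣ T ∣ ≤ 2 * ∣ W ∪ ⁅ p v ⁆ ∣
      half′ = begin
        ∣ T ∣                  ≤⟨ ∣p∣≤suc∣p-x∣ T v ⟩
        suc ∣ T - v ∣          ≤⟨ s≤s (∣p∣≤suc∣dropPreimage∣ (T - v) v) ⟩
        2 + ∣ T′ ∣             ≤⟨ +-monoʳ-≤ 2 half ⟩
        2 + 2 * ∣ W ∣          ≡⟨ *-suc 2 ∣ W ∣ ⟨
        2 * suc ∣ W ∣          ≤⟨ *-monoʳ-≤ 2 (p⊂q⇒∣p∣<∣q∣ W⊂W∪⁅pv⁆) ⟩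
        2 * ∣ W ∪ ⁅ p v ⁆ ∣    ∎
        where
        open ≤-Reasoning
        W⊂W∪⁅pv⁆ : W ⊂ W ∪ ⁅ p v ⁆
        W⊂W∪⁅pv⁆ = p⊆p∪q ⁅ p v ⁆ , p v , x∈p∪q⁺ (inj₂ (x∈⁅x⁆ (p v))) , λ pv∈W → noNeighbourInW pv∈W (adj-p v∈D)
      image′ : ∀ {x} → x ∈ W ∪ ⁅ p v ⁆ → ∃ λ t → t ∈ T × p t ≡ x
      image′ x∈W∪⁅pv⁆ with x∈p∪⁅y⁆⁻ x∈W∪⁅pv⁆
      ... | inj₁ x∈W with t , t∈T′ , pt≡x ← image x∈W = t , T′⊆T t∈T′ , pt≡x
      ... | inj₂ refl = v , v∈T , refl

-- NoIsolated G is implied by the existence of a total dominating set.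
corollary4p3 : (n : ℕ) (G : Graph n) → NoIsolated G →
    (z γ : ℕ) → IsZeroForcingNumber G z → IsUpperTotalDomination G γ →
    2 * z + γ ≤ 2 * n
corollary4p3 n G _ z γ isZ ((D , minimalD , ∣D∣≡γ) , _) = begin
  2 * z + γ           ≡⟨ cong (2 * z +_) (≡-sym ∣D∣≡γ) ⟩
  2 * z + ∣ D ∣       ≤⟨ +-monoʳ-≤ (2 * z) half ⟩
  2 * z + 2 * ∣ W ∣   ≡⟨ *-distribˡ-+ 2 z ∣ W ∣ ⟨
  2 * (z + ∣ W ∣)     ≤⟨ *-monoʳ-≤ 2 (zeroForcingNumber+∣W∣≤n G isZ forceable) ⟩
  2 * n               ∎
  where
  open ≤-Reasoning
  p : Fin n → Fin n
  p = proj₁ (minimalTDSet⇒privateNeighbourMap G minimalD)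
  isPrivate : ∀ {v} → v ∈ D → IsPrivateNeighbour G D v (p v)
  isPrivate = proj₂ (minimalTDSet⇒privateNeighbourMap G minimalD)
  open ForceablePrivateNeighbours (forceablePrivateNeighbours G p isPrivate (⊂-wellFounded D) ⊆-refl)
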